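{- Let $k\ge1$ and let $G'$ be a bipartite graph with bipartition $U\cup V$ such that $|U|,|V|\ge k+2$ and $G'$ has minimum degree at least $k+1$. Let $G$ be the graph obtained from $G'$ by adding every edge between two vertices of $U$ and every edge between two vertices of $V$. Then $G$ is $k$-canceling.
   Context: A signing of a graph $G$ is a map $\sigma:E(G)\to\{\pm1\}$; for a path $P$, $\sigma(P)=\sum_{e\in P}\sigma(e)$. In a graph $H$, $d_\sigma(u,v)=\min_P|\sigma(P)|$ over all $uv$-paths $P$ in $H$ ($\infty$ if none, $0$ if $u=v$), and $W_\sigma(H)=\frac12\sum_{u,v\in V(H)}d_\sigma(u,v)$. $G$ is $k$-canceling if there is a signing $\sigma$ such that $W_\sigma(G-S)=0$ for every $S\subseteq V(G)$ with $|S|<k$ (with $\sigma$ restricted to $G-S$ and distances computed in $G-S$). -}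

module Defs where

open import Data.Nat using (ℕ; zero; suc; _<_)
open import Data.Integer using (ℤ; +_; -[1+_]; _+_)
open import Data.Bool using (Bool; true; false; if_then_else_; _≟_)
open import Data.Fin using (Fin)
open import Data.Fin.Subset using (Subset; _∉_; ∣_∣)
open import Data.List using (List; []; _∷_; map)
open import Data.Nat.ListAction using (sum)
open import Data.List.Relation.Unary.Unique.Propositional using (Unique)
open import Data.List.Base using (allFin)
open import Data.Product using (_×_; Σ; ∃)
open import Relation.Binary.PropositionalEquality using (_≡_; _≢_)
open import Relation.Nullary using (does)

record Graph (n : ℕ) : Set where
  field
    adj   : Fin n → Fin n → Bool
    adj-sym   : ∀ u v → adj u v ≡ adj v u
    adj-irref : ∀ v → adj v v ≡ false
open Graph public

countV : {n : ℕ} → (Fin n → Bool) → ℕ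
countV {n} p = sum (map (λ w → if p w then 1 else 0) (allFin n))

degree : {n : ℕ} → Graph n → Fin n → ℕ
degree G v = countV (adj G v)

-- G' is bipartite with bipartition U ∪ V, where U = {v | side v = true},
-- V = {v | side v = false}: every edge joins a vertex of U to one of V.
IsBipartition : {n : ℕ} → Graph n → (Fin n → Bool) → Set
IsBipartition G side = ∀ u v → adj G u v ≡ true → side u ≢ side v

completeParts : {n : ℕ} → (G' : Graph n) → (side : Fin n → Bool) →
                IsBipartition G' side → Graph n
completeParts {n} G' side bip = record { adj = a ; adj-sym = s ; adj-irref = i }
  where
  open import Data.Fin using () renaming (_≟_ to _≟F_)
  open import Relation.Nullary using (yes; no)
  open import Relation.Binary.PropositionalEquality using (refl; sym)
  a : Fin n → Fin n → Bool
  a u v = if does (side u ≟ side v) then (if does (u ≟F v) then false else true)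
          else adj G' u v
  s : ∀ u v → a u v ≡ a v u
  s u v with side u ≟ side v | side v ≟ side u
  ... | yes p | no q = Data.Empty.⊥-elim (q (sym p)) where import Data.Empty
  ... | no p | yes q = Data.Empty.⊥-elim (p (sym q)) where import Data.Empty
  ... | no _ | no _ = adj-sym G' u v
  ... | yes _ | yes _ with u ≟F v | v ≟F u
  ...   | yes _ | yes _ = refl
  ...   | no _ | no _ = refl
  ...   | yes p | no q = Data.Empty.⊥-elim (q (sym p)) where import Data.Empty
  ...   | no p | yes q = Data.Empty.⊥-elim (p (sym q)) where import Data.Empty
  i : ∀ v → a v v ≡ false
  i v with side v ≟ side v
  ... | no q = Data.Empty.⊥-elim (q refl) where import Data.Empty
  ... | yes _ with v ≟F v
  ...   | yes _ = refl
  ...   | no q = Data.Empty.⊥-elim (q refl) where import Data.Empty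

-- A signing assigns ±1 to each edge: a symmetric map σ : pairs → Bool
-- (true ↦ +1, false ↦ -1); only its values on edges matter.
Signing : ℕ → Set
Signing n = Σ (Fin n → Fin n → Bool) (λ σ → ∀ u v → σ u v ≡ σ v u)

sgn : Bool → ℤ
sgn true  = + 1
sgn false = -[1+ 0 ]

signSum : {n : ℕ} → Signing n → List (Fin n) → ℤ
signSum σ []            = + 0
signSum σ (_ ∷ [])      = + 0
signSum σ (u ∷ w ∷ vs)  = sgn (Data.Product.proj₁ σ u w) + signSum σ (w ∷ vs)
  where import Data.Product

AdjMinus : {n : ℕ} → Graph n → Subset n → Fin n → Fin n → Set
AdjMinus G S u w = (adj G u w ≡ true) × (u ∉ S) × (w ∉ S)

data WalkMinus {n : ℕ} (G : Graph n) (S : Subset n) :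
       Fin n → Fin n → List (Fin n) → Set where
  stop : ∀ {u} → u ∉ S → WalkMinus G S u u (u ∷ [])
  step : ∀ {u w v vs} → AdjMinus G S u w → WalkMinus G S w v vs →
         WalkMinus G S u v (u ∷ vs)

record PathMinus {n : ℕ} (G : Graph n) (S : Subset n) (u v : Fin n) : Set where
  field
    verts    : List (Fin n)
    walk     : WalkMinus G S u v verts
    distinct : Unique verts
open PathMinus public

-- d_σ(u,v) = 0 in G - S: u = v, or some uv-path P in G - S has σ(P) = 0.
-- (d_σ takes values in ℕ ∪ {∞}; it is 0 exactly in these cases.)
DistZero : {n : ℕ} → Graph n → Subset n → Signing n → Fin n → Fin n → Set
DistZero G S σ u v = (u ≡ v) Data.Sum.⊎ ∃ (λ (P : PathMinus G S u v) → signSum σ (verts P) ≡ + 0)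
  where import Data.Sum

-- W_σ(G - S) = 0: a sum of values in ℕ ∪ {∞} is 0 iff every summand is 0,
-- i.e. d_σ(u,v) = 0 for all u, v ∈ V(G - S).
WienerZero : {n : ℕ} → Graph n → Subset n → Signing n → Set
WienerZero G S σ = ∀ u v → u ∉ S → v ∉ S → DistZero G S σ u v

Canceling : {n : ℕ} → ℕ → Graph n → Set
Canceling {n} k G = ∃ (λ (σ : Signing n) → ∀ (S : Subset n) → ∣ S ∣ < k → WienerZero G S σ)

-- Sign every edge inside U or inside V with +1 and every edge of G' with -1.
-- Since |S| < k and every vertex has more than k neighbours in G', after
-- deleting S two vertices on opposite sides are joined by a path u w v with w
-- a G'-neighbour of v on u's side (signs +1, -1), and two vertices u, v on the
-- same side by a path u x y z v with x, z their G'-neighbours and y a third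
-- vertex of the other side (signs -1, +1, +1, -1); the sizes |U|, |V| ≥ k + 2
-- leave room to choose y away from S, x and z.
module Submission where

open import Defs
open import Data.Nat using (ℕ; zero; suc; _≤_; _<_; _+_; s≤s)
open import Data.Nat.Properties
  using (≤-refl; ≤-trans; ≤-<-trans; ≤-reflexive; <⇒≤; +-suc; +-comm; +-monoʳ-≤; n≤1+n)
open import Data.Bool using (Bool; true; false; not; _xor_; if_then_else_) renaming (_≟_ to _≟ᵇ_)
open import Data.Bool.Properties using (xor-comm; xor-same; xor-inverseˡ; ¬-not)
open import Data.Fin using (Fin) renaming (zero to fzero; suc to fsuc; _≟_ to _≟ᶠ_)
open import Data.Fin.Subset using (Subset; _∈_; _∉_; _∪_; ⁅_⁆; ∣_∣)
open import Data.Fin.Subset.Properties using (∣⁅x⁆∣≡1; p⊆p∪q; q⊆p∪q; x∉⁅y⁆⇒x≢y)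
open import Data.Vec using ([]; _∷_; tabulate; here; there)
open import Data.Vec.Properties using (lookup∘tabulate; []=⇒lookup)
open import Data.List using (List; []; _∷_; length; map)
import Data.List as List
open import Data.List.Properties using (map-tabulate)
open import Data.Nat.ListAction using (sum)
open import Data.List.Relation.Unary.All using (All; []; _∷_)
open import Data.List.Relation.Unary.AllPairs using ([]; _∷_)
open import Data.Product using (_×_; _,_; ∃-syntax; proj₁)
open import Data.Sum using (inj₁; inj₂)
open import Data.Empty using (⊥-elim)
open import Data.Integer using (0ℤ)
open import Function using (_∘_)
open import Relation.Nullary using (yes; no)
open import Relation.Binary.PropositionalEquality
  using (_≡_; _≢_; refl; sym; trans; cong; subst; subst₂; ≢-sym; module ≡-Reasoning)

private
  variable
    n : ℕ

∣p∪q∣≤∣p∣+∣q∣ : (p q : Subset n) → ∣ p ∪ q ∣ ≤ ∣ p ∣ + ∣ q ∣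
∣p∪q∣≤∣p∣+∣q∣ [] [] = ≤-refl
∣p∪q∣≤∣p∣+∣q∣ (true ∷ p) (true ∷ q) =
  s≤s (≤-trans (∣p∪q∣≤∣p∣+∣q∣ p q) (≤-trans (n≤1+n _) (≤-reflexive (sym (+-suc ∣ p ∣ ∣ q ∣)))))
∣p∪q∣≤∣p∣+∣q∣ (true ∷ p) (false ∷ q) = s≤s (∣p∪q∣≤∣p∣+∣q∣ p q)
∣p∪q∣≤∣p∣+∣q∣ (false ∷ p) (true ∷ q) =
  ≤-trans (s≤s (∣p∪q∣≤∣p∣+∣q∣ p q)) (≤-reflexive (sym (+-suc ∣ p ∣ ∣ q ∣)))
∣p∪q∣≤∣p∣+∣q∣ (false ∷ p) (false ∷ q) = ∣p∪q∣≤∣p∣+∣q∣ p q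

∃∈p∉q-∷ : ∀ {a b} {p q : Subset n} → ∃[ x ] x ∈ p × x ∉ q → ∃[ x ] x ∈ a ∷ p × x ∉ b ∷ q
∃∈p∉q-∷ (x , x∈p , x∉q) = fsuc x , there x∈p , λ { (there x∈q) → x∉q x∈q }

∣q∣<∣p∣⇒∃∈p∉q : (p q : Subset n) → ∣ q ∣ < ∣ p ∣ → ∃[ x ] x ∈ p × x ∉ q
∣q∣<∣p∣⇒∃∈p∉q (true  ∷ p) (false ∷ q) _        = fzero , here , λ ()
∣q∣<∣p∣⇒∃∈p∉q (true  ∷ p) (true  ∷ q) (s≤s lt) = ∃∈p∉q-∷ (∣q∣<∣p∣⇒∃∈p∉q p q lt)
∣q∣<∣p∣⇒∃∈p∉q (false ∷ p) (true  ∷ q) lt       = ∃∈p∉q-∷ (∣q∣<∣p∣⇒∃∈p∉q p q (<⇒≤ lt))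
∣q∣<∣p∣⇒∃∈p∉q (false ∷ p) (false ∷ q) lt       = ∃∈p∉q-∷ (∣q∣<∣p∣⇒∃∈p∉q p q lt)

∣⁅x⁆∪p∣≤1+∣p∣ : (x : Fin n) (p : Subset n) → ∣ ⁅ x ⁆ ∪ p ∣ ≤ 1 + ∣ p ∣
∣⁅x⁆∪p∣≤1+∣p∣ x p = ≤-trans (∣p∪q∣≤∣p∣+∣q∣ ⁅ x ⁆ p) (≤-reflexive (cong (_+ ∣ p ∣) (∣⁅x⁆∣≡1 x)))

fresh : (p S : Subset n) (xs : List (Fin n)) → length xs + ∣ S ∣ < ∣ p ∣ →
        ∃[ w ] w ∈ p × w ∉ S × All (w ≢_) xs
fresh p S [] lt with ∣q∣<∣p∣⇒∃∈p∉q p S lt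
... | w , w∈p , w∉S = w , w∈p , w∉S , []
fresh p S (x ∷ xs) lt with fresh p (⁅ x ⁆ ∪ S) xs (≤-<-trans bound lt)
  where
  bound : length xs + ∣ ⁅ x ⁆ ∪ S ∣ ≤ suc (length xs + ∣ S ∣)
  bound = ≤-trans (+-monoʳ-≤ (length xs) (∣⁅x⁆∪p∣≤1+∣p∣ x S)) (≤-reflexive (+-suc (length xs) ∣ S ∣))
... | w , w∈p , w∉x∪S , w≢xs =
  w , w∈p , w∉x∪S ∘ q⊆p∪q ⁅ x ⁆ S , x∉⁅y⁆⇒x≢y (w∉x∪S ∘ p⊆p∪q S) ∷ w≢xs

∈-tabulate⁻ : {p : Fin n → Bool} {x : Fin n} → x ∈ tabulate p → p x ≡ true
∈-tabulate⁻ {p = p} {x} x∈p = trans (sym (lookup∘tabulate p x)) ([]=⇒lookup x∈p)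

∣b∷p∣ : (b : Bool) (p : Subset n) → ∣ b ∷ p ∣ ≡ (if b then 1 else 0) + ∣ p ∣
∣b∷p∣ true  p = refl
∣b∷p∣ false p = refl

countV-tabulate : (p : Fin n → Bool) → countV p ≡ ∣ tabulate p ∣
countV-tabulate {zero}  p = refl
countV-tabulate {suc n} p = begin
  indicator (p fzero) + sum (map (indicator ∘ p) (List.tabulate fsuc))
    ≡⟨ cong (λ t → indicator (p fzero) + sum t) (map-tabulate fsuc (indicator ∘ p)) ⟩
  indicator (p fzero) + sum (List.tabulate (indicator ∘ p ∘ fsuc))
    ≡⟨ cong (λ t → indicator (p fzero) + sum t) (sym (map-tabulate (λ w → w) (indicator ∘ p ∘ fsuc))) ⟩
  indicator (p fzero) + countV (p ∘ fsuc)
    ≡⟨ cong (indicator (p fzero) +_) (countV-tabulate (p ∘ fsuc)) ⟩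
  indicator (p fzero) + ∣ tabulate (p ∘ fsuc) ∣
    ≡⟨ sym (∣b∷p∣ (p fzero) (tabulate (p ∘ fsuc))) ⟩
  ∣ tabulate p ∣ ∎
  where
  open ≡-Reasoning
  indicator : Bool → ℕ
  indicator b = if b then 1 else 0

sideSigning : (Fin n → Bool) → Signing n
sideSigning side = (λ u w → not (side u xor side w)) , λ u w → cong not (xor-comm (side u) (side w))

xor≡true⇒≢ : ∀ {a b} → a xor b ≡ true → b ≢ a
xor≡true⇒≢ {a} a⊕a≡true refl with () ← trans (sym a⊕a≡true) (xor-same a)

∣oppositeSide∣ : (side : Fin n → Bool) {m : ℕ} → m ≤ countV side → m ≤ countV (not ∘ side) →
                 ∀ u → m ≤ ∣ tabulate (λ y → side u xor side y) ∣
∣oppositeSide∣ side hU hV u with side u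
... | true  = ≤-trans hV (≤-reflexive (countV-tabulate (not ∘ side)))
... | false = ≤-trans hU (≤-reflexive (countV-tabulate side))

module _ {n : ℕ} (G' : Graph n) (side : Fin n → Bool) (bip : IsBipartition G' side) where

  private
    G : Graph n
    G = completeParts G' side bip

    σ : Signing n
    σ = sideSigning side

    ≢-side : ∀ {u v} → side u ≢ side v → u ≢ v
    ≢-side su≢sv = su≢sv ∘ cong side

    σ-sameSide : ∀ {u w} → side u ≡ side w → proj₁ σ u w ≡ true
    σ-sameSide {u} su≡sw = trans (cong (λ b → not (side u xor b)) (sym su≡sw)) (cong not (xor-same (side u)))

    σ-crossSide : ∀ {u w} → side u ≢ side w → proj₁ σ u w ≡ false
    σ-crossSide {w = w} su≢sw = trans (cong (λ b → not (b xor side w)) (¬-not su≢sw)) (cong not (xor-inverseˡ (side w)))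

  completeParts-adj-sameSide : ∀ {u v} → side u ≡ side v → u ≢ v → adj G u v ≡ true
  completeParts-adj-sameSide {u} {v} su≡sv u≢v with side u ≟ᵇ side v | u ≟ᶠ v
  ... | no su≢sv | _       = ⊥-elim (su≢sv su≡sv)
  ... | yes _    | yes u≡v = ⊥-elim (u≢v u≡v)
  ... | yes _    | no _    = refl

  completeParts-adj-G' : ∀ {u v} → adj G' u v ≡ true → adj G u v ≡ true
  completeParts-adj-G' {u} {v} uv with side u ≟ᵇ side v
  ... | yes su≡sv = ⊥-elim (bip u v uv su≡sv)
  ... | no _      = uv

  distZero-crossSide : ∀ {S u v w} → side u ≢ side v → u ∉ S → v ∉ S →
                       adj G' v w ≡ true → w ∉ S → w ≢ u → DistZero G S σ u v
  distZero-crossSide {S} {u} {v} {w} su≢sv u∉S v∉S vw w∉S w≢u = inj₂ (path , signs)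
    where
    sw≢sv : side w ≢ side v
    sw≢sv = bip v w vw ∘ sym

    su≡sw : side u ≡ side w
    su≡sw = trans (¬-not su≢sv) (sym (¬-not sw≢sv))

    path : PathMinus G S u v
    path = record
      { verts    = u ∷ w ∷ v ∷ []
      ; walk     = step (completeParts-adj-sameSide su≡sw (≢-sym w≢u) , u∉S , w∉S)
                   (step (completeParts-adj-G' (trans (adj-sym G' w v) vw) , w∉S , v∉S)
                   (stop v∉S))
      ; distinct = (≢-sym w≢u ∷ ≢-side su≢sv ∷ []) ∷ (≢-side sw≢sv ∷ []) ∷ [] ∷ []
      }

    signs : signSum σ (u ∷ w ∷ v ∷ []) ≡ 0ℤ
    signs rewrite σ-sameSide su≡sw | σ-crossSide sw≢sv = refl

  distZero-sameSide : ∀ {S u v x y z} → side u ≡ side v → u ≢ v → u ∉ S → v ∉ S →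
                      adj G' u x ≡ true → x ∉ S →
                      adj G' v z ≡ true → z ∉ S → z ≢ x →
                      side y ≢ side u → y ∉ S → y ≢ x → y ≢ z →
                      DistZero G S σ u v
  distZero-sameSide {S} {u} {v} {x} {y} {z} su≡sv u≢v u∉S v∉S ux x∉S vz z∉S z≢x sy≢su y∉S y≢x y≢z =
    inj₂ (path , signs)
    where
    sx≢su : side x ≢ side u
    sx≢su = bip u x ux ∘ sym

    sz≢sv : side z ≢ side v
    sz≢sv = bip v z vz ∘ sym

    sx≡sy : side x ≡ side y
    sx≡sy = trans (¬-not sx≢su) (sym (¬-not sy≢su))

    sy≡sz : side y ≡ side z
    sy≡sz = trans (¬-not sy≢su) (trans (cong not su≡sv) (sym (¬-not sz≢sv)))

    u≢x : u ≢ x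
    u≢x = ≢-side (≢-sym sx≢su)

    u≢y : u ≢ y
    u≢y = ≢-side (≢-sym sy≢su)

    u≢z : u ≢ z
    u≢z = ≢-side λ su≡sz → sz≢sv (trans (sym su≡sz) su≡sv)

    x≢v : x ≢ v
    x≢v = ≢-side λ sx≡sv → sx≢su (trans sx≡sv (sym su≡sv))

    y≢v : y ≢ v
    y≢v = ≢-side λ sy≡sv → sy≢su (trans sy≡sv (sym su≡sv))

    path : PathMinus G S u v
    path = record
      { verts    = u ∷ x ∷ y ∷ z ∷ v ∷ []
      ; walk     = step (completeParts-adj-G' ux , u∉S , x∉S)
                   (step (completeParts-adj-sameSide sx≡sy (≢-sym y≢x) , x∉S , y∉S)
                   (step (completeParts-adj-sameSide sy≡sz y≢z , y∉S , z∉S)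
                   (step (completeParts-adj-G' (trans (adj-sym G' z v) vz) , z∉S , v∉S)
                   (stop v∉S))))
      ; distinct = (u≢x ∷ u≢y ∷ u≢z ∷ u≢v ∷ [])
                 ∷ (≢-sym y≢x ∷ ≢-sym z≢x ∷ x≢v ∷ [])
                 ∷ (y≢z ∷ y≢v ∷ [])
                 ∷ (≢-side sz≢sv ∷ [])
                 ∷ [] ∷ []
      }

    signs : signSum σ (u ∷ x ∷ y ∷ z ∷ v ∷ []) ≡ 0ℤ
    signs rewrite σ-crossSide (≢-sym sx≢su) | σ-sameSide sx≡sy | σ-sameSide sy≡sz | σ-crossSide sz≢sv = refl

  sideSigning-cancels : ∀ {k} → (∀ v → suc k ≤ ∣ tabulate (adj G' v) ∣) →
                        (∀ u → suc (suc k) ≤ ∣ tabulate (λ y → side u xor side y) ∣) →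
                        ∀ S → ∣ S ∣ < k → WienerZero G S σ
  sideSigning-cancels deg opp S lt u v u∉S v∉S with u ≟ᶠ v | side u ≟ᵇ side v
  ... | yes u≡v | _ = inj₁ u≡v
  ... | no _ | no su≢sv
    with fresh (tabulate (adj G' v)) S (u ∷ []) (≤-trans (s≤s lt) (deg v))
  ... | w , w∈N[v] , w∉S , w≢u ∷ [] =
    distZero-crossSide su≢sv u∉S v∉S (∈-tabulate⁻ w∈N[v]) w∉S w≢u
  sideSigning-cancels deg opp S lt u v u∉S v∉S | no u≢v | yes su≡sv
    with fresh (tabulate (adj G' u)) S [] (≤-trans (s≤s (<⇒≤ lt)) (deg u))
  ... | x , x∈N[u] , x∉S , []
    with fresh (tabulate (adj G' v)) S (x ∷ []) (≤-trans (s≤s lt) (deg v))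
  ... | z , z∈N[v] , z∉S , z≢x ∷ []
    with fresh (tabulate (λ y → side u xor side y)) S (x ∷ z ∷ []) (≤-trans (s≤s (s≤s lt)) (opp u))
  ... | y , y∈opp , y∉S , y≢x ∷ y≢z ∷ [] =
    distZero-sameSide su≡sv u≢v u∉S v∉S (∈-tabulate⁻ x∈N[u]) x∉S (∈-tabulate⁻ z∈N[v]) z∉S z≢x
                      (xor≡true⇒≢ (∈-tabulate⁻ y∈opp)) y∉S y≢x y≢z

proposition4p2 : (k n : ℕ) → 1 ≤ k →
    (G' : Graph n) → (side : Fin n → Bool) → (bip : IsBipartition G' side) →
    k + 2 ≤ countV side → k + 2 ≤ countV (λ v → not (side v)) →
    (∀ v → k + 1 ≤ degree G' v) →
    Canceling k (completeParts G' side bip)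
proposition4p2 k n _ G' side bip hU hV hdeg =
  sideSigning side , sideSigning-cancels G' side bip degree-bound opposite-bound
  where
  degree-bound : ∀ v → suc k ≤ ∣ tabulate (adj G' v) ∣
  degree-bound v = subst₂ _≤_ (+-comm k 1) (countV-tabulate (adj G' v)) (hdeg v)

  opposite-bound : ∀ u → suc (suc k) ≤ ∣ tabulate (λ y → side u xor side y) ∣
  opposite-bound = ∣oppositeSide∣ side (subst (_≤ countV side) (+-comm k 2) hU)
                                        (subst (_≤ countV (not ∘ side)) (+-comm k 2) hV)
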